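{- Let $\Gamma=\Gamma(\mathbb{Z}_n,S)$ be a circulant digraph and let $m\ge4$ be a divisor of $n$ with $\gcd(m,n/m)=1$. Identify $\mathbb{Z}_n$ with $\mathbb{Z}_{n/m}\times\mathbb{Z}_m$ in the natural way. Then $\Gamma$ is of deleted wreath type with $m$ being the divisor in the definition if and only if ${\rm Aut}(\Gamma)$ contains a subgroup $H\times S_m$ acting canonically on $\mathbb{Z}_{n/m}\times\mathbb{Z}_m$ (with $H$ acting on the first coordinate and $S_m$ on the second), for some 2-closed group $H$ with $\mathbb{Z}_{n/m}\le H\le S_{n/m}$.
   Context: $\Gamma(\mathbb{Z}_n,S)$ has vertex set $\mathbb{Z}_n$ and arc set $\{(u,v):u-v\in S\}$, $S\subseteq\mathbb{Z}_n\setminus\{0\}$. $\Gamma$ is of deleted wreath type with divisor $m$ (where $m\mid n$, $\gcd(m,n/m)=1$) if, with $L=\langle n/m\rangle$ the subgroup of order $m$ in $\mathbb{Z}_n$, $S\cap L\in\{\emptyset,L\setminus\{0\}\}$ and for every $g\in\langle m\rangle\setminus\{0\}$, $S\cap(g+L)\in\{\emptyset,\{g\},(g+L)\setminus\{g\},g+L\}$. Here $\mathbb{Z}_{n/m}\le H$ means $H$ contains the regular cyclic group of translations of $\mathbb{Z}_{n/m}$. A permutation group is 2-closed if it equals the largest permutation group having the same orbits on ordered pairs of points. -}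

module Defs where

open import Data.Nat using (ℕ; _+_; _*_; _≤_; _<_)
open import Data.Nat.Divisibility using (_∣_)
open import Data.Fin using (Fin; toℕ)
open import Data.Fin.Subset using (Subset; _∈_; _∉_)
open import Data.Fin.Permutation using (Permutation′; _⟨$⟩ʳ_; id; flip; _∘ₚ_)
open import Data.Product using (Σ; ∃; _×_)
open import Data.Sum using (_⊎_)
open import Data.Empty using (⊥)
open import Data.Unit using (⊤)
open import Relation.Binary.PropositionalEquality using (_≡_; _≢_)
open import Relation.Nullary using (¬_)
open import Level using (Level) renaming (suc to lsuc; zero to lzero)

ModEq : ℕ → ℕ → ℕ → Set
ModEq d a b = ∃ λ q → (a ≡ b + q * d) ⊎ (b ≡ a + q * d)

Arc : (n : ℕ) → Subset n → Fin n → Fin n → Set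
Arc n S u v = ∃ λ (s : Fin n) → s ∈ S × ModEq n (toℕ u) (toℕ v + toℕ s)

ConnectionSet : (n : ℕ) → Subset n → Set
ConnectionSet n S = ∀ (s : Fin n) → s ∈ S → toℕ s ≢ 0

AgreeOn : {n : ℕ} → Subset n → (Fin n → Set) → (Fin n → Set) → Set
AgreeOn {n} S C P = ∀ (x : Fin n) → C x → (x ∈ S → P x) × (P x → x ∈ S)

-- Deleted wreath type with divisor m, where n = k * m (k = n/m).
-- L = ⟨n/m⟩ = {x : k ∣ x};  ⟨m⟩ = {x : m ∣ x};  g + L = {x : x ≡ g mod k}.
DeletedWreathType : (n m k : ℕ) → Subset n → Set
DeletedWreathType n m k S =
  (AgreeOn S InL (λ _ → ⊥) ⊎ AgreeOn S InL (λ x → toℕ x ≢ 0))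
  × (∀ (g : Fin n) → m ∣ toℕ g → toℕ g ≢ 0 →
       AgreeOn S (coset g) (λ _ → ⊥)
     ⊎ AgreeOn S (coset g) (λ x → x ≡ g)
     ⊎ AgreeOn S (coset g) (λ x → x ≢ g)
     ⊎ AgreeOn S (coset g) (λ _ → ⊤))
  where
  InL : Fin n → Set
  InL x = k ∣ toℕ x
  coset : Fin n → Fin n → Set
  coset g x = ModEq k (toℕ x) (toℕ g)

IsAut : (n : ℕ) → Subset n → Permutation′ n → Set
IsAut n S σ = ∀ (u v : Fin n) →
  (Arc n S u v → Arc n S (σ ⟨$⟩ʳ u) (σ ⟨$⟩ʳ v)) × (Arc n S (σ ⟨$⟩ʳ u) (σ ⟨$⟩ʳ v) → Arc n S u v)

record PermGroup (k : ℕ) : Set₁ where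
  field
    mem   : Permutation′ k → Set
    resp  : ∀ (σ τ : Permutation′ k) → (∀ x → σ ⟨$⟩ʳ x ≡ τ ⟨$⟩ʳ x) → mem σ → mem τ
    id∈   : mem id
    comp∈ : ∀ (σ τ : Permutation′ k) → mem σ → mem τ → mem (σ ∘ₚ τ)
    inv∈  : ∀ (σ : Permutation′ k) → mem σ → mem (flip σ)

open PermGroup public

SubgroupOf : {k : ℕ} → PermGroup k → PermGroup k → Set
SubgroupOf {k} G H = ∀ (σ : Permutation′ k) → mem G σ → mem H σ

PairOrbit : {k : ℕ} → PermGroup k → Fin k → Fin k → Fin k → Fin k → Set
PairOrbit {k} G x y x' y' =
  ∃ λ (g : Permutation′ k) → mem G g × (g ⟨$⟩ʳ x ≡ x') × (g ⟨$⟩ʳ y ≡ y')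

SameOrbitals : {k : ℕ} → PermGroup k → PermGroup k → Set
SameOrbitals {k} G H = ∀ (x y x' y' : Fin k) →
  (PairOrbit G x y x' y' → PairOrbit H x y x' y') × (PairOrbit H x y x' y' → PairOrbit G x y x' y')

-- H is 2-closed: H is the largest permutation group with the same orbits on
-- ordered pairs as H, i.e. every group with the same orbitals is contained in H.
TwoClosed : {k : ℕ} → PermGroup k → Set₁
TwoClosed {k} H = ∀ (G : PermGroup k) → SameOrbitals G H → SubgroupOf G H

ContainsTranslations : {k : ℕ} → PermGroup k → Set
ContainsTranslations {k} H = ∀ (σ : Permutation′ k) (c : ℕ) →
  (∀ (x : Fin k) → ModEq k (toℕ (σ ⟨$⟩ʳ x)) (toℕ x + c)) → mem H σ

-- σ on Z_n corresponds, under Z_n ≅ Z_k × Z_m (x ↦ (x mod k, x mod m)),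
-- to the permutation (a,b) ↦ (h a, τ b)
Realizes : (n m k : ℕ) → Permutation′ n → Permutation′ k → Permutation′ m → Set
Realizes n m k σ h τ = ∀ (x : Fin n) (a : Fin k) (b : Fin m) →
  ModEq k (toℕ x) (toℕ a) → ModEq m (toℕ x) (toℕ b) →
  ModEq k (toℕ (σ ⟨$⟩ʳ x)) (toℕ (h ⟨$⟩ʳ a)) × ModEq m (toℕ (σ ⟨$⟩ʳ x)) (toℕ (τ ⟨$⟩ʳ b))

ContainsCanonical : (n m k : ℕ) → Subset n → PermGroup k → Set
ContainsCanonical n m k S H =
  ∀ (h : Permutation′ k) → mem H h → ∀ (τ : Permutation′ m) (σ : Permutation′ n) →
    Realizes n m k σ h τ → IsAut n S σ

-- Under the Chinese remainder isomorphism ℤₙ ≅ ℤₖ × ℤₘ (k = n/m), being of deleted wreath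
-- type says exactly that whether x ∈ S depends only on x mod k and on whether x mod m
-- vanishes ("homogeneity"). For such S, (a, b) → (a′, b′) is an arc iff crt (a − a′) (b − b′)
-- ∈ S, which depends on b − b′ only through whether it is zero, a property every τ ∈ Sₘ
-- preserves. Hence h × τ is an automorphism whenever h preserves each of the m "layers"
-- (a, a′) ↦ crt (a − a′) j ∈ S. Their common automorphism group H contains the translations
-- of ℤₖ and, like the automorphism group of any family of binary relations, is 2-closed.
-- Conversely, if id × Sₘ acts by automorphisms, then for x, y with equal residues mod k and
-- nonzero residues mod m, id × (transposition of their residues mod m) fixes 0 and sends x
-- to y, so x ∈ S implies y ∈ S; homogeneity then forces every coset g + L to meet S in one
-- of the four shapes allowed by the definition.
module Submission where

open import Defs
import Algebra.Properties.CommutativeSemigroup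
open import Data.Nat using (ℕ; zero; suc; _+_; _*_; _∸_; _≤_; _<_; _≟_; NonZero)
open import Data.Nat.Properties
  using ( +-comm; +-assoc; +-identityʳ; *-comm; *-assoc; *-identityʳ; *-distribʳ-+; +-cancelˡ-≡
        ; +-commutativeSemigroup; m+[n∸m]≡n; m+n≡0⇒m≡0; ≤-total; m≤n⇒∃[o]m+o≡n; m*n≢0; <⇒≤)
open import Data.Nat.DivMod
open import Data.Nat.Divisibility
  using (_∣_; _∣0; divides; n∣m*n; ∣n⇒∣m*n; m%n≡0⇒n∣m; n∣m⇒m%n≡0)
open import Data.Nat.Coprimality using (Coprime; coprime-Bézout; coprime-divisor; gcd≡1⇒coprime)
import Data.Nat.Coprimality as Coprimality
open import Data.Nat.GCD using (gcd; module Bézout)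
open import Data.Nat.Tactic.RingSolver using (solve-∀)
open import Data.Fin using (Fin; zero; toℕ)
open import Data.Fin.Properties using (toℕ<n; toℕ-fromℕ<; toℕ-injective; any?)
import Data.Fin.Properties as Fin
open import Data.Fin.Subset using (Subset; _∈_; _∉_)
open import Data.Fin.Subset.Properties using (_∈?_)
open import Data.Fin.Permutation
  using (Permutation′; _⟨$⟩ʳ_; _⟨$⟩ˡ_; permutation; flip; id; transpose; inverseʳ)
import Data.Fin.Permutation.Components as PC
open import Data.Product using (Σ; ∃; _×_; _,_; proj₁; proj₂)
open import Data.Sum using (_⊎_; inj₁; inj₂)
open import Data.Empty using (⊥; ⊥-elim)
open import Data.Unit using (⊤; tt)
open import Function.Base using (_∘_)
open import Function.Bundles using (_⇔_; mk⇔; Equivalence; Injection)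
open import Function.Construct.Composition using (_⇔-∘_)
open import Function.Construct.Identity using (⇔-id)
open import Function.Construct.Symmetry using (⇔-sym)
open import Function.Properties.Equivalence using (⇔-setoid)
open import Function.Properties.Inverse using (↔⇒↣)
open import Level using (0ℓ)
import Relation.Binary.Reasoning.Setoid as SetoidReasoning
open import Relation.Binary.PropositionalEquality
open import Relation.Nullary using (¬_; Dec; yes; no)
open import Relation.Nullary.Decidable using (dec-true; dec-false; _×-dec_; ¬?; decidable-stable)

open Equivalence using (to; from)

private
  module ⇔-Reasoning = SetoidReasoning (⇔-setoid 0ℓ)
  module +-Semigroup = Algebra.Properties.CommutativeSemigroup +-commutativeSemigroup

fzero : ∀ {d} .{{_ : NonZero d}} → Fin d
fzero {suc _} = zero

toℕ-fzero : ∀ {d} .{{_ : NonZero d}} → toℕ (fzero {d}) ≡ 0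
toℕ-fzero {suc _} = refl

module _ {d : ℕ} .{{_ : NonZero d}} where

  modEq⇒%≡ : ∀ {a b} → ModEq d a b → a % d ≡ b % d
  modEq⇒%≡ {b = b} (q , inj₁ refl) = [m+kn]%n≡m%n b q d
  modEq⇒%≡ {a}     (q , inj₂ refl) = sym ([m+kn]%n≡m%n a q d)

  private
    ≤-quotient⇒+* : ∀ {a b} → a % d ≡ b % d → a / d ≤ b / d → ∃ λ q → b ≡ a + q * d
    ≤-quotient⇒+* {a} {b} a≡b a/d≤b/d with q , a/d+q≡b/d ← m≤n⇒∃[o]m+o≡n a/d≤b/d = q , (begin
      b                           ≡⟨ m≡m%n+[m/n]*n b d ⟩
      b % d + b / d * d           ≡⟨ cong₂ (λ r s → r + s * d) (sym a≡b) (sym a/d+q≡b/d) ⟩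
      a % d + (a / d + q) * d     ≡⟨ cong (a % d +_) (*-distribʳ-+ d (a / d) q) ⟩
      a % d + (a / d * d + q * d) ≡⟨ +-assoc (a % d) _ _ ⟨
      a % d + a / d * d + q * d   ≡⟨ cong (_+ q * d) (m≡m%n+[m/n]*n a d) ⟨
      a + q * d                   ∎)
      where open ≡-Reasoning

  %≡⇒modEq : ∀ {a b} → a % d ≡ b % d → ModEq d a b
  %≡⇒modEq {a} {b} a≡b with ≤-total (a / d) (b / d)
  ... | inj₁ a/d≤b/d = let q , b≡a+qd = ≤-quotient⇒+* a≡b a/d≤b/d in q , inj₂ b≡a+qd
  ... | inj₂ b/d≤a/d = let q , a≡b+qd = ≤-quotient⇒+* (sym a≡b) b/d≤a/d in q , inj₁ a≡b+qd

  %-+-congˡ : ∀ c {a b} → a % d ≡ b % d → (c + a) % d ≡ (c + b) % d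
  %-+-congˡ c {a} {b} a≡b = begin
    (c + a) % d           ≡⟨ %-distribˡ-+ c a d ⟩
    (c % d + a % d) % d   ≡⟨ cong (λ r → (c % d + r) % d) a≡b ⟩
    (c % d + b % d) % d   ≡⟨ %-distribˡ-+ c b d ⟨
    (c + b) % d           ∎
    where open ≡-Reasoning

  %-+-congʳ : ∀ c {a b} → a % d ≡ b % d → (a + c) % d ≡ (b + c) % d
  %-+-congʳ c {a} {b} a≡b =
    trans (cong (_% d) (+-comm a c)) (trans (%-+-congˡ c a≡b) (cong (_% d) (+-comm c b)))

  %-*-congˡ : ∀ c {a b} → a % d ≡ b % d → (c * a) % d ≡ (c * b) % d
  %-*-congˡ c {a} {b} a≡b = begin
    (c * a) % d           ≡⟨ %-distribˡ-* c a d ⟩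
    (c % d * (a % d)) % d ≡⟨ cong (λ r → (c % d * r) % d) a≡b ⟩
    (c % d * (b % d)) % d ≡⟨ %-distribˡ-* c b d ⟨
    (c * b) % d           ∎
    where open ≡-Reasoning

  +-%≡⇒∣ : ∀ b x → (b + x) % d ≡ b % d → d ∣ x
  +-%≡⇒∣ b x b+x≡b with %≡⇒modEq b+x≡b
  ... | q , inj₁ b+x≡b+qd = divides q (+-cancelˡ-≡ b x (q * d) b+x≡b+qd)
  ... | q , inj₂ b≡b+x+qd = divides 0 (m+n≡0⇒m≡0 x (sym (+-cancelˡ-≡ b 0 (x + q * d)
          (trans (+-identityʳ b) (trans b≡b+x+qd (+-assoc b x (q * d)))))))

  %≡-∣ : ∀ {e a b} .{{_ : NonZero e}} → e ∣ d → a % d ≡ b % d → a % e ≡ b % e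
  %≡-∣ {e} {a} {b} e∣d a≡b = begin
    a % e       ≡⟨ m∣n⇒o%n%m≡o%m e d a e∣d ⟨
    a % d % e   ≡⟨ cong (_% e) a≡b ⟩
    b % d % e   ≡⟨ m∣n⇒o%n%m≡o%m e d b e∣d ⟩
    b % e       ∎
    where open ≡-Reasoning

  toℕ-mod : ∀ a → toℕ (a mod d) ≡ a % d
  toℕ-mod a = toℕ-fromℕ< (m%n<n a d)

  toℕ-mod-% : ∀ a → toℕ (a mod d) % d ≡ a % d
  toℕ-mod-% a = trans (cong (_% d) (toℕ-mod a)) (m%n%n≡m%n a d)

  toℕ-%-injective : ∀ {i j : Fin d} → toℕ i % d ≡ toℕ j % d → i ≡ j
  toℕ-%-injective {i} {j} i≡j =
    toℕ-injective (trans (sym (m<n⇒m%n≡m (toℕ<n i))) (trans i≡j (m<n⇒m%n≡m (toℕ<n j))))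

  mod-cong : ∀ {a b} → a % d ≡ b % d → a mod d ≡ b mod d
  mod-cong {a} {b} a≡b = toℕ-%-injective (trans (toℕ-mod-% a) (trans a≡b (sym (toℕ-mod-% b))))

  mod-injective : ∀ {a b} → a mod d ≡ b mod d → a % d ≡ b % d
  mod-injective {a} {b} eq = trans (sym (toℕ-mod a)) (trans (cong toℕ eq) (toℕ-mod b))

  mod-toℕ : ∀ (i : Fin d) → toℕ i mod d ≡ i
  mod-toℕ i = toℕ-%-injective (toℕ-mod-% (toℕ i))

  modEq⇔mod≡ : ∀ {a b} → ModEq d a b ⇔ a mod d ≡ b mod d
  modEq⇔mod≡ = mk⇔ (mod-cong ∘ modEq⇒%≡) (%≡⇒modEq ∘ mod-injective)

  modEq⇒mod≡ : ∀ {a} {i : Fin d} → ModEq d a (toℕ i) → a mod d ≡ i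
  modEq⇒mod≡ {i = i} a≡i = trans (to modEq⇔mod≡ a≡i) (mod-toℕ i)

  mod≡⇒modEq : ∀ {a} {i : Fin d} → a mod d ≡ i → ModEq d a (toℕ i)
  mod≡⇒modEq {i = i} a≡i = from modEq⇔mod≡ (trans a≡i (sym (mod-toℕ i)))

  ∣⇔toℕ-mod≡0 : ∀ {a} → d ∣ a ⇔ toℕ (a mod d) ≡ 0
  ∣⇔toℕ-mod≡0 {a} = mk⇔ (λ d∣a → trans (toℕ-mod a) (n∣m⇒m%n≡0 a d d∣a))
                        (λ a%d≡0 → m%n≡0⇒n∣m a d (trans (sym (toℕ-mod a)) a%d≡0))

  toℕ-mod-0 : ∀ {a} → a ≡ 0 → toℕ (a mod d) ≡ 0
  toℕ-mod-0 a≡0 = to ∣⇔toℕ-mod≡0 (subst (d ∣_) (sym a≡0) (d ∣0))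

toℕ-mod-mod : ∀ {d e} .{{_ : NonZero d}} .{{_ : NonZero e}} → e ∣ d →
              ∀ a → toℕ (a mod d) mod e ≡ a mod e
toℕ-mod-mod {d} {e} e∣d a = mod-cong (trans (cong (_% e) (toℕ-mod a)) (m∣n⇒o%n%m≡o%m e d a e∣d))

-- Subtraction in ℤ_d

module _ {d : ℕ} .{{_ : NonZero d}} where

  infixl 6 _⊖_

  _⊖_ : Fin d → Fin d → Fin d
  i ⊖ j = (toℕ i + (d ∸ toℕ j)) mod d

  private
    j+[d∸j]≡d : ∀ (j : Fin d) → toℕ j + (d ∸ toℕ j) ≡ d
    j+[d∸j]≡d j = m+[n∸m]≡n (<⇒≤ (toℕ<n j))

  ⊖-spec : ∀ i j → (toℕ j + toℕ (i ⊖ j)) % d ≡ toℕ i % d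
  ⊖-spec i j = begin
    (toℕ j + toℕ (i ⊖ j)) % d             ≡⟨ %-+-congˡ (toℕ j) (toℕ-mod-% _) ⟩
    (toℕ j + (toℕ i + (d ∸ toℕ j))) % d   ≡⟨ cong (_% d) (+-Semigroup.x∙yz≈y∙xz (toℕ j) (toℕ i) _) ⟩
    (toℕ i + (toℕ j + (d ∸ toℕ j))) % d   ≡⟨ cong (λ r → (toℕ i + r) % d) (j+[d∸j]≡d j) ⟩
    (toℕ i + d) % d                        ≡⟨ [m+n]%n≡m%n (toℕ i) d ⟩
    toℕ i % d                              ∎
    where open ≡-Reasoning

  ⊖-unique : ∀ {i j c} → (toℕ j + toℕ c) % d ≡ toℕ i % d → c ≡ i ⊖ j
  ⊖-unique {i} {j} {c} j+c≡i = trans (sym (mod-toℕ c)) (mod-cong (begin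
    toℕ c % d                             ≡⟨ [m+n]%n≡m%n (toℕ c) d ⟨
    (toℕ c + d) % d                       ≡⟨ cong (λ r → (toℕ c + r) % d) (j+[d∸j]≡d j) ⟨
    (toℕ c + (toℕ j + (d ∸ toℕ j))) % d   ≡⟨ cong (_% d) (+-Semigroup.x∙yz≈yx∙z (toℕ c) (toℕ j) _) ⟩
    (toℕ j + toℕ c + (d ∸ toℕ j)) % d     ≡⟨ %-+-congʳ (d ∸ toℕ j) j+c≡i ⟩
    (toℕ i + (d ∸ toℕ j)) % d             ∎))
    where open ≡-Reasoning

  ⊖-identityʳ : ∀ i → i ⊖ fzero ≡ i
  ⊖-identityʳ i = sym (⊖-unique (cong (λ r → (r + toℕ i) % d) toℕ-fzero))

  ⊖-≡0⇔≡ : ∀ {i j} → toℕ (i ⊖ j) ≡ 0 ⇔ i ≡ j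
  ⊖-≡0⇔≡ {i} {j} = mk⇔ ⊖-≡0⇒≡ (λ { refl → ⊖-self })
    where
    open ≡-Reasoning
    ⊖-self : toℕ (i ⊖ i) ≡ 0
    ⊖-self = trans (toℕ-mod _) (trans (cong (_% d) (j+[d∸j]≡d i)) (n%n≡0 d))
    ⊖-≡0⇒≡ : toℕ (i ⊖ j) ≡ 0 → i ≡ j
    ⊖-≡0⇒≡ i⊖j≡0 = sym (toℕ-%-injective (begin
      toℕ j % d                   ≡⟨ cong (_% d) (+-identityʳ (toℕ j)) ⟨
      (toℕ j + 0) % d             ≡⟨ cong (λ r → (toℕ j + r) % d) i⊖j≡0 ⟨
      (toℕ j + toℕ (i ⊖ j)) % d   ≡⟨ ⊖-spec i j ⟩
      toℕ i % d                   ∎))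

  ⊖-translation : ∀ c {i j i′ j′} → toℕ i′ % d ≡ (toℕ i + c) % d → toℕ j′ % d ≡ (toℕ j + c) % d →
                  i′ ⊖ j′ ≡ i ⊖ j
  ⊖-translation c {i} {j} {i′} {j′} i′≡i+c j′≡j+c = sym (⊖-unique (begin
    (toℕ j′ + toℕ (i ⊖ j)) % d      ≡⟨ %-+-congʳ (toℕ (i ⊖ j)) j′≡j+c ⟩
    (toℕ j + c + toℕ (i ⊖ j)) % d   ≡⟨ cong (_% d) (+-Semigroup.xy∙z≈xz∙y (toℕ j) c _) ⟩
    (toℕ j + toℕ (i ⊖ j) + c) % d   ≡⟨ %-+-congʳ c (⊖-spec i j) ⟩
    (toℕ i + c) % d                  ≡⟨ i′≡i+c ⟨
    toℕ i′ % d                       ∎))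
    where open ≡-Reasoning

⊖-mod : ∀ {d e} .{{_ : NonZero d}} .{{_ : NonZero e}} → e ∣ d →
        ∀ (u v : Fin d) → toℕ (u ⊖ v) mod e ≡ toℕ u mod e ⊖ toℕ v mod e
⊖-mod {d} {e} e∣d u v = ⊖-unique (begin
  (toℕ (toℕ v mod e) + toℕ (toℕ (u ⊖ v) mod e)) % e
    ≡⟨ cong₂ (λ r s → (r + s) % e) (toℕ-mod (toℕ v)) (toℕ-mod _) ⟩
  (toℕ v % e + toℕ (u ⊖ v) % e) % e   ≡⟨ %-distribˡ-+ (toℕ v) _ e ⟨
  (toℕ v + toℕ (u ⊖ v)) % e           ≡⟨ %≡-∣ e∣d (⊖-spec u v) ⟩
  toℕ u % e                           ≡⟨ toℕ-mod-% (toℕ u) ⟨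
  toℕ (toℕ u mod e) % e               ∎)
  where open ≡-Reasoning

arc⇔⊖∈ : ∀ {n} .{{_ : NonZero n}} (S : Subset n) u v → Arc n S u v ⇔ u ⊖ v ∈ S
arc⇔⊖∈ S u v = mk⇔
  (λ (s , s∈S , u≡v+s) → subst (_∈ S) (⊖-unique (sym (modEq⇒%≡ u≡v+s))) s∈S)
  (λ u⊖v∈S → u ⊖ v , u⊖v∈S , %≡⇒modEq (sym (⊖-spec u v)))

arc-to-0⇔∈ : ∀ {n} .{{_ : NonZero n}} (S : Subset n) z → Arc n S z fzero ⇔ z ∈ S
arc-to-0⇔∈ S z = subst (Arc _ S z fzero ⇔_) (cong (_∈ S) (⊖-identityʳ z)) (arc⇔⊖∈ S z fzero)

-- The Chinese remainder theorem

module _ {k m : ℕ} .{{_ : NonZero k}} .{{_ : NonZero m}} (coprime : Coprime m k) where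

  private
    +multiple-%≡ : .{{_ : NonZero (k * m)}} → ∀ b q → (b + q * k) % m ≡ b % m →
                   (b + q * k) % (k * m) ≡ b % (k * m)
    +multiple-%≡ b q b+qk≡b
      with divides u refl ← coprime-divisor coprime (subst (m ∣_) (*-comm q k) (+-%≡⇒∣ b (q * k) b+qk≡b))
      = trans (cong (λ r → (b + r) % (k * m)) (trans (*-assoc u m k) (cong (u *_) (*-comm m k))))
              ([m+kn]%n≡m%n b u (k * m))

    square-identity : ∀ x y → 1 + x ≡ y → x * x + 2 * y ≡ 1 + y * y
    square-identity x _ refl = identity x
      where identity : ∀ x → x * x + 2 * (1 + x) ≡ 1 + (1 + x) * (1 + x)
            identity = solve-∀

    idempotent : ∃ λ e → m ∣ e × e % k ≡ 1 % k
    idempotent with coprime-Bézout coprime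
    ... | Bézout.+- x y 1+yk≡xm =
      x * m , n∣m*n x , trans (cong (_% k) (sym 1+yk≡xm)) ([m+kn]%n≡m%n 1 y k)
    -- Here x m ≡ -1 (mod k), so its square is ≡ 1.
    ... | Bézout.-+ x y 1+xm≡yk = x * m * (x * m) , ∣n⇒∣m*n (x * m) (n∣m*n x) , (begin
      (x * m * (x * m)) % k                 ≡⟨ [m+kn]%n≡m%n _ (2 * y) k ⟨
      (x * m * (x * m) + 2 * y * k) % k     ≡⟨ cong (λ r → (x * m * (x * m) + r) % k) (*-assoc 2 y k) ⟩
      (x * m * (x * m) + 2 * (y * k)) % k   ≡⟨ cong (_% k) (square-identity (x * m) (y * k) 1+xm≡yk) ⟩
      (1 + y * k * (y * k)) % k             ≡⟨ cong (λ r → (1 + r) % k) (*-assoc (y * k) y k) ⟨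
      (1 + y * k * y * k) % k               ≡⟨ [m+kn]%n≡m%n 1 (y * k * y) k ⟩
      1 % k                                 ∎)
      where open ≡-Reasoning

  crt-unique : .{{_ : NonZero (k * m)}} → ∀ {a b} → a % k ≡ b % k → a % m ≡ b % m →
               a % (k * m) ≡ b % (k * m)
  crt-unique {a} {b} a≡b[k] a≡b[m] with %≡⇒modEq a≡b[k]
  ... | q , inj₁ refl = +multiple-%≡ b q a≡b[m]
  ... | q , inj₂ refl = sym (+multiple-%≡ a q (sym a≡b[m]))

  ∃-multiple-%≡ : ∀ a → ∃ λ g → m ∣ g × g % k ≡ a % k
  ∃-multiple-%≡ a with e , m∣e , e≡1 ← idempotent =
    a * e , ∣n⇒∣m*n a m∣e , trans (%-*-congˡ a e≡1) (cong (_% k) (*-identityʳ a))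

crt-exists : ∀ {k m} .{{_ : NonZero k}} .{{_ : NonZero m}} → Coprime m k →
             ∀ a b → ∃ λ g → g % k ≡ a % k × g % m ≡ b % m
crt-exists coprime a b
  with g₁ , m∣g₁ , g₁≡a ← ∃-multiple-%≡ coprime a
     | g₂ , k∣g₂ , g₂≡b ← ∃-multiple-%≡ (Coprimality.sym coprime) b
  = g₁ + g₂ , trans (%-remove-+ʳ g₁ k∣g₂) g₁≡a , trans (%-remove-+ˡ g₂ m∣g₁) g₂≡b

module ChineseRemainder {k m : ℕ} .{{_ : NonZero k}} .{{_ : NonZero m}} (coprime : Coprime m k) where

  n : ℕ
  n = k * m

  instance
    n≢0 : NonZero n
    n≢0 = m*n≢0 k m

  k∣n : k ∣ n
  k∣n = divides m (*-comm k m)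

  m∣n : m ∣ n
  m∣n = divides k refl

  resₖ : Fin n → Fin k
  resₖ x = toℕ x mod k

  resₘ : Fin n → Fin m
  resₘ x = toℕ x mod m

  residues-injective : ∀ {x y} → resₖ x ≡ resₖ y → resₘ x ≡ resₘ y → x ≡ y
  residues-injective xₖ≡yₖ xₘ≡yₘ =
    toℕ-%-injective (crt-unique coprime (mod-injective xₖ≡yₖ) (mod-injective xₘ≡yₘ))

  -- Opaque, so that unification never unfolds the Bézout computation behind crt.
  opaque
    private
      solution : ∀ (a : Fin k) (b : Fin m) → ∃ λ g → g % k ≡ toℕ a % k × g % m ≡ toℕ b % m
      solution a b = crt-exists coprime (toℕ a) (toℕ b)

    crt : Fin k → Fin m → Fin n
    crt a b = proj₁ (solution a b) mod n

    resₖ-crt : ∀ a b → resₖ (crt a b) ≡ a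
    resₖ-crt a b =
      trans (toℕ-mod-mod k∣n _) (trans (mod-cong (proj₁ (proj₂ (solution a b)))) (mod-toℕ a))

    resₘ-crt : ∀ a b → resₘ (crt a b) ≡ b
    resₘ-crt a b =
      trans (toℕ-mod-mod m∣n _) (trans (mod-cong (proj₂ (proj₂ (solution a b)))) (mod-toℕ b))

  crt-residues : ∀ x → crt (resₖ x) (resₘ x) ≡ x
  crt-residues x = residues-injective (resₖ-crt _ _) (resₘ-crt _ _)

  private
    onResidues : (Fin k → Fin k) → (Fin m → Fin m) → Fin n → Fin n
    onResidues f g x = crt (f (resₖ x)) (g (resₘ x))

    onResidues-inverse : ∀ (h : Permutation′ k) (τ : Permutation′ m) x →
      onResidues (h ⟨$⟩ʳ_) (τ ⟨$⟩ʳ_) (onResidues (h ⟨$⟩ˡ_) (τ ⟨$⟩ˡ_) x) ≡ x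
    onResidues-inverse h τ x = trans
      (cong₂ crt (trans (cong (h ⟨$⟩ʳ_) (resₖ-crt _ _)) (inverseʳ h))
                 (trans (cong (τ ⟨$⟩ʳ_) (resₘ-crt _ _)) (inverseʳ τ)))
      (crt-residues x)

  infixr 7 _⊗_

  _⊗_ : Permutation′ k → Permutation′ m → Permutation′ n
  h ⊗ τ = permutation (onResidues (h ⟨$⟩ʳ_) (τ ⟨$⟩ʳ_)) (onResidues (h ⟨$⟩ˡ_) (τ ⟨$⟩ˡ_))
    (onResidues-inverse h τ) (onResidues-inverse (flip h) (flip τ))

  ⊗-realizes : ∀ h τ → Realizes n m k (h ⊗ τ) h τ
  ⊗-realizes h τ x a b x≡a x≡b =
    mod≡⇒modEq (trans (resₖ-crt _ _) (cong (h ⟨$⟩ʳ_) (modEq⇒mod≡ x≡a))) ,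
    mod≡⇒modEq (trans (resₘ-crt _ _) (cong (τ ⟨$⟩ʳ_) (modEq⇒mod≡ x≡b)))

  realizes⇒residues : ∀ σ h τ → Realizes n m k σ h τ →
    ∀ x → resₖ (σ ⟨$⟩ʳ x) ≡ h ⟨$⟩ʳ resₖ x × resₘ (σ ⟨$⟩ʳ x) ≡ τ ⟨$⟩ʳ resₘ x
  realizes⇒residues σ h τ realizes x
    with σx≡ha , σx≡τb ← realizes x (resₖ x) (resₘ x) (mod≡⇒modEq refl) (mod≡⇒modEq refl)
    = modEq⇒mod≡ σx≡ha , modEq⇒mod≡ σx≡τb

-- Automorphism groups of binary relations

Automorphisms : ∀ {k} {I : Set} → (I → Fin k → Fin k → Set) → PermGroup k
Automorphisms R = record
  { mem   = λ h → ∀ i a a′ → R i a a′ ⇔ R i (h ⟨$⟩ʳ a) (h ⟨$⟩ʳ a′)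
  ; resp  = λ σ τ σ≗τ σ∈ i a a′ →
              subst₂ (λ b b′ → R i a a′ ⇔ R i b b′) (σ≗τ a) (σ≗τ a′) (σ∈ i a a′)
  ; id∈   = λ _ _ _ → ⇔-id _
  ; comp∈ = λ σ τ σ∈ τ∈ i a a′ → τ∈ i _ _ ⇔-∘ σ∈ i a a′
  ; inv∈  = λ σ σ∈ i a a′ → ⇔-sym (subst₂ (λ b b′ → R i (σ ⟨$⟩ˡ a) (σ ⟨$⟩ˡ a′) ⇔ R i b b′)
              (inverseʳ σ) (inverseʳ σ) (σ∈ i (σ ⟨$⟩ˡ a) (σ ⟨$⟩ˡ a′)))
  }

automorphisms-twoClosed : ∀ {k} {I : Set} (R : I → Fin k → Fin k → Set) → TwoClosed (Automorphisms R)
automorphisms-twoClosed R G sameOrbitals σ σ∈G i a a′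
  with h , h∈Aut , ha≡σa , ha′≡σa′ ←
         proj₁ (sameOrbitals a a′ (σ ⟨$⟩ʳ a) (σ ⟨$⟩ʳ a′)) (σ , σ∈G , refl , refl)
  = subst₂ (λ b b′ → R i a a′ ⇔ R i b b′) ha≡σa ha′≡σa′ (h∈Aut i a a′)

permutation-≡⇔ : ∀ {d} (π : Permutation′ d) {i j} → i ≡ j ⇔ π ⟨$⟩ʳ i ≡ π ⟨$⟩ʳ j
permutation-≡⇔ π = mk⇔ (cong (π ⟨$⟩ʳ_)) (Injection.injective (↔⇒↣ π))

transpose-matchˡ : ∀ {d} (i j : Fin d) → PC.transpose i j i ≡ j
transpose-matchˡ i j rewrite dec-true (i Fin.≟ i) refl = refl

transpose-other : ∀ {d} {i j c : Fin d} → c ≢ i → c ≢ j → PC.transpose i j c ≡ c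
transpose-other {i = i} {j} {c} c≢i c≢j
  rewrite dec-false (c Fin.≟ i) c≢i | dec-false (c Fin.≟ j) c≢j = refl

-- Circulant digraphs on ℤₖ × ℤₘ

module Circulant {k m : ℕ} .{{_ : NonZero k}} .{{_ : NonZero m}} (coprime : Coprime m k)
                 (S : Subset (k * m)) where

  open ChineseRemainder coprime

  Homogeneous : Set
  Homogeneous = ∀ x y → resₖ x ≡ resₖ y → toℕ (resₘ x) ≢ 0 → toℕ (resₘ y) ≢ 0 → x ∈ S → y ∈ S

  Layer : Fin m → Fin k → Fin k → Set
  Layer j a a′ = crt (a ⊖ a′) j ∈ S

  arc⇔layer : ∀ u v → Arc n S u v ⇔ Layer (resₘ u ⊖ resₘ v) (resₖ u) (resₖ v)
  arc⇔layer u v = subst (Arc n S u v ⇔_) (cong (_∈ S) u⊖v≡crt) (arc⇔⊖∈ S u v)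
    where
    u⊖v≡crt : u ⊖ v ≡ crt (resₖ u ⊖ resₖ v) (resₘ u ⊖ resₘ v)
    u⊖v≡crt = residues-injective (trans (⊖-mod k∣n u v) (sym (resₖ-crt _ _)))
                                 (trans (⊖-mod m∣n u v) (sym (resₘ-crt _ _)))

  layer-cong : Homogeneous → ∀ {j j′} → (toℕ j ≡ 0 ⇔ toℕ j′ ≡ 0) →
               ∀ a a′ → Layer j a a′ ⇔ Layer j′ a a′
  layer-cong homogeneous j≡0⇔j′≡0 a a′ = mk⇔ (transfer j≡0⇔j′≡0) (transfer (⇔-sym j≡0⇔j′≡0))
    where
    transfer : ∀ {j j′} → (toℕ j ≡ 0 ⇔ toℕ j′ ≡ 0) → Layer j a a′ → Layer j′ a a′
    transfer {j} {j′} j≡0⇔j′≡0 with toℕ j ≟ 0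
    ... | yes j≡0 = subst (λ i → Layer i a a′) (toℕ-injective (trans j≡0 (sym (to j≡0⇔j′≡0 j≡0))))
    ... | no j≢0 = homogeneous (crt c j) (crt c j′) (trans (resₖ-crt c j) (sym (resₖ-crt c j′)))
                     (λ jₘ≡0 → j≢0 (trans (cong toℕ (sym (resₘ-crt c j))) jₘ≡0))
                     (λ j′ₘ≡0 → j≢0 (from j≡0⇔j′≡0 (trans (cong toℕ (sym (resₘ-crt c j′))) j′ₘ≡0)))
      where c = a ⊖ a′

  layers-translations : ContainsTranslations (Automorphisms Layer)
  layers-translations σ c σ≗+c j a a′ = subst (λ d → Layer j a a′ ⇔ crt d j ∈ S)
    (sym (⊖-translation c (modEq⇒%≡ (σ≗+c a)) (modEq⇒%≡ (σ≗+c a′)))) (⇔-id _)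

  layers-canonical : Homogeneous → ContainsCanonical n m k S (Automorphisms Layer)
  layers-canonical homogeneous h h∈Aut τ σ realizes u v = to arcs⇔ , from arcs⇔
    where
    open ⇔-Reasoning
    uₖ = resₖ u ; vₖ = resₖ v ; uₘ = resₘ u ; vₘ = resₘ v
    σu = σ ⟨$⟩ʳ u ; σv = σ ⟨$⟩ʳ v
    τuₘ = τ ⟨$⟩ʳ uₘ ; τvₘ = τ ⟨$⟩ʳ vₘ

    σ-layer : Layer (resₘ σu ⊖ resₘ σv) (resₖ σu) (resₖ σv) ≡ Layer (τuₘ ⊖ τvₘ) (h ⟨$⟩ʳ uₖ) (h ⟨$⟩ʳ vₖ)
    σ-layer with σuₖ , σuₘ ← realizes⇒residues σ h τ realizes u
                | σvₖ , σvₘ ← realizes⇒residues σ h τ realizes v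
      rewrite σuₖ | σuₘ | σvₖ | σvₘ = refl

    τ-preserves-zero : toℕ (uₘ ⊖ vₘ) ≡ 0 ⇔ toℕ (τuₘ ⊖ τvₘ) ≡ 0
    τ-preserves-zero = begin
      toℕ (uₘ ⊖ vₘ) ≡ 0     ≈⟨ ⊖-≡0⇔≡ ⟩
      uₘ ≡ vₘ               ≈⟨ permutation-≡⇔ τ ⟩
      τuₘ ≡ τvₘ             ≈⟨ ⊖-≡0⇔≡ ⟨
      toℕ (τuₘ ⊖ τvₘ) ≡ 0   ∎

    arcs⇔ : Arc n S u v ⇔ Arc n S σu σv
    arcs⇔ = begin
      Arc n S u v                                     ≈⟨ arc⇔layer u v ⟩
      Layer (uₘ ⊖ vₘ) uₖ vₖ                           ≈⟨ layer-cong homogeneous τ-preserves-zero uₖ vₖ ⟩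
      Layer (τuₘ ⊖ τvₘ) uₖ vₖ                         ≈⟨ h∈Aut _ uₖ vₖ ⟩
      Layer (τuₘ ⊖ τvₘ) (h ⟨$⟩ʳ uₖ) (h ⟨$⟩ʳ vₖ)       ≡⟨ σ-layer ⟨
      Layer (resₘ σu ⊖ resₘ σv) (resₖ σu) (resₖ σv)   ≈⟨ arc⇔layer σu σv ⟨
      Arc n S σu σv                                   ∎

  homogeneous⇒canonical : Homogeneous →
    Σ (PermGroup k) (λ H → TwoClosed H × ContainsTranslations H × ContainsCanonical n m k S H)
  homogeneous⇒canonical homogeneous =
    Automorphisms Layer , automorphisms-twoClosed Layer , layers-translations , layers-canonical homogeneous

  canonical⇒homogeneous : ∀ H → ContainsCanonical n m k S H → Homogeneous
  canonical⇒homogeneous H canonical x y xₖ≡yₖ xₘ≢0 yₘ≢0 x∈S =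
    to (arc-to-0⇔∈ S y) (subst₂ (Arc n S) σx≡y σ0≡0 (proj₁ (σ-aut x fzero) (from (arc-to-0⇔∈ S x) x∈S)))
    where
    τ : Permutation′ m
    τ = transpose (resₘ x) (resₘ y)

    σ : Permutation′ n
    σ = id ⊗ τ

    σ-aut : IsAut n S σ
    σ-aut = canonical id (id∈ H) τ σ (⊗-realizes id τ)

    σx≡y : σ ⟨$⟩ʳ x ≡ y
    σx≡y = residues-injective (trans (resₖ-crt _ _) xₖ≡yₖ)
                              (trans (resₘ-crt _ _) (transpose-matchˡ (resₘ x) (resₘ y)))

    0ₘ≢ : ∀ {z} → toℕ (resₘ z) ≢ 0 → resₘ fzero ≢ resₘ z
    0ₘ≢ zₘ≢0 0ₘ≡zₘ = zₘ≢0 (trans (cong toℕ (sym 0ₘ≡zₘ)) (toℕ-mod-0 toℕ-fzero))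

    σ0≡0 : σ ⟨$⟩ʳ fzero ≡ fzero
    σ0≡0 = residues-injective (resₖ-crt _ _)
                              (trans (resₘ-crt _ _) (transpose-other (0ₘ≢ xₘ≢0) (0ₘ≢ yₘ≢0)))

  private
    Coset : Fin n → Fin n → Set
    Coset g x = ModEq k (toℕ x) (toℕ g)

    coset⇔resₖ≡ : ∀ {g x} → Coset g x ⇔ resₖ x ≡ resₖ g
    coset⇔resₖ≡ = modEq⇔mod≡

  deletedWreath⇒homogeneous : DeletedWreathType n m k S → Homogeneous
  deletedWreath⇒homogeneous shape x y xₖ≡yₖ xₘ≢0 yₘ≢0 x∈S = by-shape (toℕ g ≟ 0)
    where
    g : Fin n
    g = crt (resₖ x) fzero

    x∈g+L : Coset g x
    x∈g+L = from coset⇔resₖ≡ (sym (resₖ-crt _ _))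

    y∈g+L : Coset g y
    y∈g+L = from coset⇔resₖ≡ (trans (sym xₖ≡yₖ) (sym (resₖ-crt _ _)))

    m∣g : m ∣ toℕ g
    m∣g = from ∣⇔toℕ-mod≡0 (trans (cong toℕ (resₘ-crt _ _)) toℕ-fzero)

    ≢g : ∀ {z} → toℕ (resₘ z) ≢ 0 → z ≢ g
    ≢g zₘ≢0 z≡g = zₘ≢0 (trans (cong (toℕ ∘ resₘ) z≡g) (to ∣⇔toℕ-mod≡0 m∣g))

    inL : toℕ g ≡ 0 → ∀ {z} → Coset g z → k ∣ toℕ z
    inL g≡0 z∈g+L = from ∣⇔toℕ-mod≡0 (trans (cong toℕ (to coset⇔resₖ≡ z∈g+L)) (toℕ-mod-0 g≡0))

    by-shape : Dec (toℕ g ≡ 0) → y ∈ S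
    by-shape (yes g≡0) with proj₁ shape
    ... | inj₁ L∩S≡∅   = ⊥-elim (proj₁ (L∩S≡∅ x (inL g≡0 x∈g+L)) x∈S)
    ... | inj₂ L∩S≡L∖0 = proj₂ (L∩S≡L∖0 y (inL g≡0 y∈g+L)) (λ y≡0 → yₘ≢0 (toℕ-mod-0 y≡0))
    by-shape (no g≢0) with proj₂ shape g m∣g g≢0
    ... | inj₁ g+L∩S≡∅                = ⊥-elim (proj₁ (g+L∩S≡∅ x x∈g+L) x∈S)
    ... | inj₂ (inj₁ g+L∩S≡g)         = ⊥-elim (≢g xₘ≢0 (proj₁ (g+L∩S≡g x x∈g+L) x∈S))
    ... | inj₂ (inj₂ (inj₁ g+L∩S≡∖g)) = proj₂ (g+L∩S≡∖g y y∈g+L) (≢g yₘ≢0)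
    ... | inj₂ (inj₂ (inj₂ g+L⊆S))    = proj₂ (g+L⊆S y y∈g+L) tt

  private
    OffCentreMember : Fin n → Fin n → Set
    OffCentreMember g x = resₖ x ≡ resₖ g × x ≢ g × x ∈ S

    CosetShape : Fin n → Set
    CosetShape g = AgreeOn S (Coset g) (λ _ → ⊥) ⊎ AgreeOn S (Coset g) (_≡ g)
                 ⊎ AgreeOn S (Coset g) (_≢ g) ⊎ AgreeOn S (Coset g) (λ _ → ⊤)

  coset-shape : Homogeneous → ∀ g → m ∣ toℕ g → CosetShape g
  coset-shape homogeneous g m∣g =
    by-cases (g ∈? S) (any? λ x → resₖ x Fin.≟ resₖ g ×-dec ¬? (x Fin.≟ g) ×-dec x ∈? S)
    where
    nonzero : ∀ {x} → resₖ x ≡ resₖ g → x ≢ g → toℕ (resₘ x) ≢ 0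
    nonzero xₖ≡gₖ x≢g xₘ≡0 =
      x≢g (residues-injective xₖ≡gₖ (toℕ-injective (trans xₘ≡0 (sym (to ∣⇔toℕ-mod≡0 m∣g)))))

    ≡g : ¬ ∃ (OffCentreMember g) → ∀ {x} → Coset g x → x ∈ S → x ≡ g
    ≡g ∄x {x} x∈g+L x∈S =
      decidable-stable (x Fin.≟ g) λ x≢g → ∄x (x , to coset⇔resₖ≡ x∈g+L , x≢g , x∈S)

    spread : ∃ (OffCentreMember g) → ∀ {x} → Coset g x → x ≢ g → x ∈ S
    spread (x₀ , x₀ₖ≡gₖ , x₀≢g , x₀∈S) x∈g+L x≢g = homogeneous x₀ _ (trans x₀ₖ≡gₖ (sym xₖ≡gₖ))
      (nonzero x₀ₖ≡gₖ x₀≢g) (nonzero xₖ≡gₖ x≢g) x₀∈S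
      where xₖ≡gₖ = to coset⇔resₖ≡ x∈g+L

    fill : g ∈ S → ∃ (OffCentreMember g) → ∀ {x} → Dec (x ≡ g) → Coset g x → x ∈ S
    fill g∈S _  (yes refl) _     = g∈S
    fill _   x₀ (no x≢g)   x∈g+L = spread x₀ x∈g+L x≢g

    by-cases : Dec (g ∈ S) → Dec (∃ (OffCentreMember g)) → CosetShape g
    by-cases (no g∉S)  (no ∄x)  = inj₁ λ x x∈g+L →
      (λ x∈S → g∉S (subst (_∈ S) (≡g ∄x x∈g+L x∈S) x∈S)) , ⊥-elim
    by-cases (yes g∈S) (no ∄x)  = inj₂ (inj₁ λ x x∈g+L →
      ≡g ∄x x∈g+L , λ { refl → g∈S })
    by-cases (no g∉S)  (yes x₀) = inj₂ (inj₂ (inj₁ λ x x∈g+L →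
      (λ x∈S x≡g → g∉S (subst (_∈ S) x≡g x∈S)) , spread x₀ x∈g+L))
    by-cases (yes g∈S) (yes x₀) = inj₂ (inj₂ (inj₂ λ x x∈g+L →
      (λ _ → tt) , λ _ → fill g∈S x₀ (x Fin.≟ g) x∈g+L))

  homogeneous⇒deletedWreath : ConnectionSet n S → Homogeneous → DeletedWreathType n m k S
  homogeneous⇒deletedWreath connectionSet homogeneous =
    L-shape (coset-shape homogeneous fzero m∣0) , λ g m∣g _ → coset-shape homogeneous g m∣g
    where
    m∣0 : m ∣ toℕ (fzero {n})
    m∣0 = subst (m ∣_) (sym toℕ-fzero) (m ∣0)

    inL⇒coset : ∀ {x} → k ∣ toℕ x → Coset fzero x
    inL⇒coset (divides q x≡qk) = q , inj₁ (trans x≡qk (cong (_+ q * k) (sym toℕ-fzero)))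

    0∈L : Coset fzero fzero
    0∈L = 0 , inj₁ (sym (+-identityʳ _))

    0∉S : fzero ∉ S
    0∉S 0∈S = connectionSet fzero 0∈S toℕ-fzero

    L-shape : CosetShape fzero →
      AgreeOn S (λ x → k ∣ toℕ x) (λ _ → ⊥) ⊎ AgreeOn S (λ x → k ∣ toℕ x) (λ x → toℕ x ≢ 0)
    L-shape (inj₁ L∩S≡∅)                 = inj₁ λ x k∣x → L∩S≡∅ x (inL⇒coset k∣x)
    L-shape (inj₂ (inj₁ L∩S≡0))          = ⊥-elim (0∉S (proj₂ (L∩S≡0 fzero 0∈L) refl))
    L-shape (inj₂ (inj₂ (inj₁ L∩S≡L∖0))) = inj₂ λ x k∣x → connectionSet x , λ x≢0 →
      proj₂ (L∩S≡L∖0 x (inL⇒coset k∣x)) (λ x≡0 → x≢0 (trans (cong toℕ x≡0) toℕ-fzero))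
    L-shape (inj₂ (inj₂ (inj₂ L⊆S)))     = ⊥-elim (0∉S (proj₂ (L⊆S fzero 0∈L) tt))

lemma2p16 : (n m k : ℕ) → 0 < n → n ≡ k * m → 4 ≤ m → gcd m k ≡ 1 →
    (S : Subset n) → ConnectionSet n S →
    (DeletedWreathType n m k S →
    Σ (PermGroup k) (λ H → TwoClosed H × ContainsTranslations H × ContainsCanonical n m k S H))
    × (Σ (PermGroup k) (λ H → TwoClosed H × ContainsTranslations H × ContainsCanonical n m k S H) →
    DeletedWreathType n m k S)
lemma2p16 _ m zero () refl _ _ S _
lemma2p16 _ zero (suc k) _ refl () _ S _
lemma2p16 _ (suc m) (suc k) _ refl _ gcd≡1 S connectionSet =
  homogeneous⇒canonical ∘ deletedWreath⇒homogeneous ,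
  homogeneous⇒deletedWreath connectionSet ∘ (λ (H , _ , _ , canonical) → canonical⇒homogeneous H canonical)
  where open Circulant {suc k} {suc m} (gcd≡1⇒coprime gcd≡1) S
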